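{- Let $Y$ be a cohesive generalized truncation of a multigraph $X$, with matching edges $F(M_0)$. If $\mathcal{E}\subseteq F(M_0)$ is an edge cut of $Y$ (i.e. $Y\setminus\mathcal{E}$ is disconnected), then the set $\mathcal{E}'=\{e\in E(X): F(e)\in\mathcal{E}\}$ of edges of $X$ corresponding to the edges of $\mathcal{E}$ is an edge cut of $X$ (i.e. $X\setminus\mathcal{E}'$ is disconnected).
   Context: A multigraph may have multiple edges but no loops; it is assumed to have no isolated vertices. Generalized truncation of $X$: take a matching $M_0$ with $|M_0|=|E(X)|$ (on $2|E(X)|$ new vertices) and a bijection $F:E(X)\to M_0$; for each edge $e$ of $X$ with ends $u,v$, label one end of $F(e)$ by $u$ and the other by $v$. For $v\in V(X)$, the cluster $\mathrm{cl}(v)$ is the set of vertices labelled $v$; insert an arbitrary graph $\mathrm{con}(v)$ (the constituent at $v$) on $\mathrm{cl}(v)$. The graph $Y=F(M_0)\cup\bigcup_v\mathrm{con}(v)$ is a generalized truncation of $X$; the edge $F(e)$ corresponds to $e$. A generalized truncation is cohesive if every constituent $\mathrm{con}(v)$ is connected. -}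

module Defs where

open import Data.Nat using (ℕ)
open import Data.Fin using (Fin)
open import Data.Bool using (Bool; true; false)
open import Data.Product using (Σ; ∃; _×_; _,_; proj₁; proj₂)
open import Data.Sum using (_⊎_)
open import Relation.Nullary using (¬_)
open import Relation.Binary.PropositionalEquality using (_≡_; _≢_)
open import Relation.Binary.Construct.Closure.ReflexiveTransitive using (Star)

record Multigraph : Set where
  field
    nV     : ℕ
    nE     : ℕ
    ends   : Fin nE → Fin nV × Fin nV
    noLoop : ∀ e → proj₁ (ends e) ≢ proj₂ (ends e)
    noIsolated : ∀ v → ∃ λ e → (proj₁ (ends e) ≡ v) ⊎ (proj₂ (ends e) ≡ v)

Connected : {V : Set} → (V → V → Set) → Set
Connected {V} adj = ∀ (x y : V) → Star adj x y

Disconnected : {V : Set} → (V → V → Set) → Set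
Disconnected adj = ¬ Connected adj

module _ (X : Multigraph) where
  open Multigraph X

  adjMinus : (Fin nE → Set) → Fin nV → Fin nV → Set
  adjMinus C u w = ∃ λ e → ¬ C e × ((ends e ≡ (u , w)) ⊎ (ends e ≡ (w , u)))

  -- Vertices of a generalized truncation: the two ends of the matching edge F(e)
  -- are (e , false), labelled by proj₁ (ends e), and (e , true), labelled by proj₂ (ends e).
  TVertex : Set
  TVertex = Fin nE × Bool

  label : TVertex → Fin nV
  label (e , false) = proj₁ (ends e)
  label (e , true)  = proj₂ (ends e)

  -- A generalized truncation of X: the union of the constituents is given by an
  -- adjacency relation on TVertex that only joins vertices in the same cluster.
  record GenTruncation : Set₁ where
    field
      conAdj     : TVertex → TVertex → Set
      conInClust : ∀ x y → conAdj x y → label x ≡ label y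

    conEdge : TVertex → TVertex → Set
    conEdge x y = conAdj x y ⊎ conAdj y x

    matchEdge : Fin nE → TVertex → TVertex → Set
    matchEdge e x y = ((x ≡ (e , false)) × (y ≡ (e , true)))
                    ⊎ ((x ≡ (e , true)) × (y ≡ (e , false)))

    -- Y minus a set 𝓔 ⊆ F(M₀) of matching edges (indexed by E(X) via F)
    adjYMinus : (Fin nE → Set) → TVertex → TVertex → Set
    adjYMinus 𝓔 x y = conEdge x y ⊎ (∃ λ e → ¬ 𝓔 e × matchEdge e x y)

    Cohesive : Set
    Cohesive = ∀ (v : Fin nV) (x y : TVertex) → label x ≡ v → label y ≡ v
               → Star conEdge x y

-- Contrapositive: if X ∖ 𝓔′ is connected, so is Y ∖ 𝓔. Each edge e ∉ 𝓔′ of a walk in X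
-- is replaced by the matching edge F(e), which survives in Y ∖ 𝓔, and consecutive
-- matching edges are joined inside a cluster, which is connected by cohesion.
module Submission where

open import Defs
open import Data.Fin using (Fin)
open import Data.Bool using (true; false)
open import Data.Product using (∃; _×_; _,_; proj₁; proj₂)
open import Data.Sum using (inj₁; inj₂)
open import Relation.Binary.PropositionalEquality using (_≡_; refl; cong)
open import Relation.Binary.Construct.Closure.ReflexiveTransitive using (Star; ε; _◅_; _◅◅_; gmap)
open import Function using (id)

module _ {T V : Set} (p : T → V) where

  Lifts : (T → T → Set) → V → V → Set
  Lifts S u w = ∀ t → p t ≡ u → ∃ λ t′ → p t′ ≡ w × Star S t t′

  FibresConnected : (T → T → Set) → Set
  FibresConnected S = ∀ v x y → p x ≡ v → p y ≡ v → Star S x y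

  Star-lifts : {R : V → V → Set} {S : T → T → Set}
             → (∀ {u w} → R u w → Lifts S u w)
             → ∀ {u w} → Star R u w → Lifts S u w
  Star-lifts lift-step ε        t pt = t , pt , ε
  Star-lifts lift-step (r ◅ rs) t pt with lift-step r t pt
  ... | t₁ , pt₁ , t↝t₁ with Star-lifts lift-step rs t₁ pt₁
  ... | t₂ , pt₂ , t₁↝t₂ = t₂ , pt₂ , t↝t₁ ◅◅ t₁↝t₂

  connected-lift : {R : V → V → Set} {S : T → T → Set}
                 → FibresConnected S
                 → (∀ {u w} → R u w → Lifts S u w)
                 → Connected R → Connected S
  connected-lift fibres-connected lift-step R-connected x y
    with Star-lifts lift-step (R-connected (p x) (p y)) x refl
  ... | t , pt , x↝t = x↝t ◅◅ fibres-connected (p y) t y pt refl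

module _ (X : Multigraph) (Y : GenTruncation X) (𝓔 : Fin (Multigraph.nE X) → Set) where
  open Multigraph X
  open GenTruncation Y

  cohesive⇒clusters-connected : Cohesive → FibresConnected (label X) (adjYMinus 𝓔)
  cohesive⇒clusters-connected cohesive v x y lx ly = gmap id inj₁ (cohesive v x y lx ly)

  adjMinus-lifts : Cohesive → ∀ {u w} → adjMinus X 𝓔 u w → Lifts (label X) (adjYMinus 𝓔) u w
  adjMinus-lifts cohesive {u} (e , e∉𝓔 , inj₁ ends≡) t lt =
    (e , true) , cong proj₂ ends≡ ,
    cohesive⇒clusters-connected cohesive u t (e , false) lt (cong proj₁ ends≡)
      ◅◅ inj₂ (e , e∉𝓔 , inj₁ (refl , refl)) ◅ ε
  adjMinus-lifts cohesive {u} (e , e∉𝓔 , inj₂ ends≡) t lt =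
    (e , false) , cong proj₁ ends≡ ,
    cohesive⇒clusters-connected cohesive u t (e , true) lt (cong proj₂ ends≡)
      ◅◅ inj₂ (e , e∉𝓔 , inj₂ (refl , refl)) ◅ ε

lemma3p4 : (X : Multigraph) (Y : GenTruncation X)
           → GenTruncation.Cohesive Y
           → (𝓔 : Fin (Multigraph.nE X) → Set)
           → Disconnected (GenTruncation.adjYMinus Y 𝓔)
           → Disconnected (adjMinus X 𝓔)
lemma3p4 X Y cohesive 𝓔 Y∖𝓔-disconnected X∖𝓔′-connected =
  Y∖𝓔-disconnected
    (connected-lift (label X)
      (cohesive⇒clusters-connected X Y 𝓔 cohesive)
      (adjMinus-lifts X Y 𝓔 cohesive)
      X∖𝓔′-connected)
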